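{- Let $T\subseteq X_0$ be a generalised nice set such that $T\setminus X$ is a generalised nice set. Then there are no distinct $i,j\in I$ with $\{i,i\}\in T$ and $\{j,i*j\}\in T$.
   Context: Let $I=\{1,\dots,7\}$ and $I_0=I\cup\{0\}$. The Fano plane on $I$ has the seven lines $\{1,2,5\},\{5,6,7\},\{1,4,7\},\{1,3,6\},\{2,4,6\},\{2,3,7\},\{3,4,5\}$. For distinct $i,j\in I$, $i*j$ is the third point of the unique line containing $i$ and $j$. The operation is extended to $I_0$ by $0*i=i*0=i$ and $i*i=0$ for all $i\in I_0$. Let $X_0$ be the set of unordered pairs $\{i,j\}$ with $i,j\in I_0$, where $i=j$ is allowed, and $X=\{\{i,j\}:i,j\in I,\ i\neq j\}$. For $i,j,k\in I_0$ let $P_{\{i,j,k\}}=\{\{i,j\},\{j,k\},\{k,i\},\{i,j*k\},\{j,k*i\},\{k,i*j\}\}\subseteq X_0$. A subset $T\subseteq X_0$ is a generalised nice set if for all $i,j,k\in I_0$, $\{i,j\}\in T$ and $\{i*j,k\}\in T$ imply $P_{\{i,j,k\}}\subseteq T$. -}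

module Defs where

open import Data.Nat using (ℕ; zero; suc)
open import Data.Fin using (Fin; zero; suc; _≤_; _≤?_)
open import Data.Nat.Properties using (≰⇒>; <⇒≤)
open import Data.Product using (Σ; _×_; _,_; proj₁; proj₂)
open import Data.Sum using (_⊎_)
open import Data.Vec using (Vec; _∷_; []; lookup)
open import Relation.Binary.PropositionalEquality using (_≡_; _≢_)
open import Relation.Nullary using (¬_; yes; no)

I₀ : Set
I₀ = Fin 8

InI : I₀ → Set
InI i = i ≢ zero

-- The operation * on I₀: 0*i = i*0 = i, i*i = 0, and for distinct i,j ∈ I,
-- i*j is the third point of the Fano line through i and j, where the lines are
-- {1,2,5},{5,6,7},{1,4,7},{1,3,6},{2,4,6},{2,3,7},{3,4,5}.
mulTable : Vec (Vec ℕ 8) 8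
mulTable =
    (0 ∷ 1 ∷ 2 ∷ 3 ∷ 4 ∷ 5 ∷ 6 ∷ 7 ∷ [])
  ∷ (1 ∷ 0 ∷ 5 ∷ 6 ∷ 7 ∷ 2 ∷ 3 ∷ 4 ∷ [])
  ∷ (2 ∷ 5 ∷ 0 ∷ 7 ∷ 6 ∷ 1 ∷ 4 ∷ 3 ∷ [])
  ∷ (3 ∷ 6 ∷ 7 ∷ 0 ∷ 5 ∷ 4 ∷ 1 ∷ 2 ∷ [])
  ∷ (4 ∷ 7 ∷ 6 ∷ 5 ∷ 0 ∷ 3 ∷ 2 ∷ 1 ∷ [])
  ∷ (5 ∷ 2 ∷ 1 ∷ 4 ∷ 3 ∷ 0 ∷ 7 ∷ 6 ∷ [])
  ∷ (6 ∷ 3 ∷ 4 ∷ 1 ∷ 2 ∷ 7 ∷ 0 ∷ 5 ∷ [])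
  ∷ (7 ∷ 4 ∷ 3 ∷ 2 ∷ 1 ∷ 6 ∷ 5 ∷ 0 ∷ [])
  ∷ []

toI₀ : ℕ → I₀
toI₀ 0 = zero
toI₀ 1 = suc zero
toI₀ 2 = suc (suc zero)
toI₀ 3 = suc (suc (suc zero))
toI₀ 4 = suc (suc (suc (suc zero)))
toI₀ 5 = suc (suc (suc (suc (suc zero))))
toI₀ 6 = suc (suc (suc (suc (suc (suc zero)))))
toI₀ _ = suc (suc (suc (suc (suc (suc (suc zero))))))

infixl 7 _*_
_*_ : I₀ → I₀ → I₀
i * j = toI₀ (lookup (lookup mulTable i) j)

-- Unordered pairs {i,j} with i,j ∈ I₀ (i = j allowed): the set X₀,
-- represented canonically as ordered pairs (a , b) with a ≤ b.
X₀ : Set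
X₀ = Σ (I₀ × I₀) (λ p → proj₁ p ≤ proj₂ p)

⟅_,_⟆ : I₀ → I₀ → X₀
⟅ i , j ⟆ with i ≤? j
... | yes i≤j = (i , j) , i≤j
... | no  i≰j = (j , i) , <⇒≤ (≰⇒> i≰j)

SubsetX₀ : Set₁
SubsetX₀ = X₀ → Set

_∈ₚ_ : X₀ → SubsetX₀ → Set
p ∈ₚ T = T p

InX : X₀ → Set
InX ((a , b) , _) = InI a × InI b × a ≢ b

_∖X : SubsetX₀ → SubsetX₀
(T ∖X) p = T p × ¬ InX p

P⊆ : I₀ → I₀ → I₀ → SubsetX₀ → Set
P⊆ i j k T =
    (⟅ i , j ⟆ ∈ₚ T) × (⟅ j , k ⟆ ∈ₚ T) × (⟅ k , i ⟆ ∈ₚ T)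
  × (⟅ i , j * k ⟆ ∈ₚ T) × (⟅ j , k * i ⟆ ∈ₚ T) × (⟅ k , i * j ⟆ ∈ₚ T)

GenNice : SubsetX₀ → Set
GenNice T = ∀ (i j k : I₀) → ⟅ i , j ⟆ ∈ₚ T → ⟅ i * j , k ⟆ ∈ₚ T → P⊆ i j k T

{-# OPTIONS --safe #-}
-- Put k = i * j.  Niceness of T applied to {j, k} and {j * k, i} = {i, i}
-- yields {k, i} and {i, j}; applied to {i, k} and {i * k, i} = {j, i} it yields
-- {k, i * i} = {0, k}.  Neither {i, i} nor {0, k} lies in X, so niceness of
-- T ∖ X applied to them puts {i, k} into T ∖ X, although {i, k} ∈ X because
-- i and k are distinct and nonzero.
module Submission where

open import Defs
open import Data.Empty using (⊥-elim)
open import Data.Product using (Σ; _×_; _,_; proj₁; proj₂; uncurry)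
open import Data.Sum using ([_,_])
open import Data.Fin using (zero; _≤_; _≤?_)
open import Data.Fin.Properties using (_≟_; all?; ≤-antisym; ≤-irrelevant; ≤-total)
open import Relation.Binary.PropositionalEquality
  using (_≡_; _≢_; refl; sym; cong; subst; module ≡-Reasoning)
open import Relation.Nullary using (¬_; yes; no)
open import Relation.Nullary.Decidable using (from-yes)

-- (I₀, *, 0) is the group (ℤ/2)³: the Fano lines are the triples {a, b, a * b}
-- of nonzero vectors of 𝔽₂³.

*-identityˡ : ∀ a → zero * a ≡ a
*-identityˡ = from-yes (all? λ a → zero * a ≟ a)

*-identityʳ : ∀ a → a * zero ≡ a
*-identityʳ = from-yes (all? λ a → a * zero ≟ a)

*-self : ∀ a → a * a ≡ zero
*-self = from-yes (all? λ a → a * a ≟ zero)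

*-comm : ∀ a b → a * b ≡ b * a
*-comm = from-yes (all? λ a → all? λ b → a * b ≟ b * a)

*-assoc : ∀ a b c → a * b * c ≡ a * (b * c)
*-assoc = from-yes (all? λ a → all? λ b → all? λ c → a * b * c ≟ a * (b * c))

a*[a*b]≡b : ∀ a b → a * (a * b) ≡ b
a*[a*b]≡b a b = begin
  a * (a * b)  ≡⟨ sym (*-assoc a a b) ⟩
  a * a * b    ≡⟨ cong (_* b) (*-self a) ⟩
  zero * b     ≡⟨ *-identityˡ b ⟩
  b            ∎
  where open ≡-Reasoning

b*[a*b]≡a : ∀ a b → b * (a * b) ≡ a
b*[a*b]≡a a b = begin
  b * (a * b)  ≡⟨ cong (b *_) (*-comm a b) ⟩
  b * (b * a)  ≡⟨ a*[a*b]≡b b a ⟩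
  a            ∎
  where open ≡-Reasoning

a*b≡0⇒a≡b : ∀ a b → a * b ≡ zero → a ≡ b
a*b≡0⇒a≡b a b a*b≡0 = begin
  a            ≡⟨ sym (*-identityʳ a) ⟩
  a * zero     ≡⟨ cong (a *_) (sym a*b≡0) ⟩
  a * (a * b)  ≡⟨ a*[a*b]≡b a b ⟩
  b            ∎
  where open ≡-Reasoning

a*b≡a⇒b≡0 : ∀ a b → a * b ≡ a → b ≡ zero
a*b≡a⇒b≡0 a b a*b≡a = begin
  b            ≡⟨ sym (a*[a*b]≡b a b) ⟩
  a * (a * b)  ≡⟨ cong (a *_) a*b≡a ⟩
  a * a        ≡⟨ *-self a ⟩
  zero         ∎
  where open ≡-Reasoning

pair-≡ : ∀ {a b : I₀} → a ≡ b → (p : a ≤ b) (q : b ≤ a) →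
         _≡_ {A = X₀} ((a , b) , p) ((b , a) , q)
pair-≡ refl p q = cong (_ ,_) (≤-irrelevant p q)

⟅⟆-comm : ∀ a b → ⟅ a , b ⟆ ≡ ⟅ b , a ⟆
⟅⟆-comm a b with a ≤? b | b ≤? a
... | yes a≤b | yes b≤a = pair-≡ (≤-antisym a≤b b≤a) a≤b b≤a
... | yes a≤b | no _    = cong ((a , b) ,_) (≤-irrelevant a≤b _)
... | no _    | yes b≤a = cong ((b , a) ,_) (≤-irrelevant _ b≤a)
... | no a≰b  | no b≰a  = ⊥-elim ([ a≰b , b≰a ] (≤-total a b))

InX-⟅⟆ : ∀ a b → InI a → InI b → a ≢ b → InX ⟅ a , b ⟆
InX-⟅⟆ a b a≢0 b≢0 a≢b with a ≤? b
... | yes _ = a≢0 , b≢0 , a≢b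
... | no _  = b≢0 , a≢0 , λ b≡a → a≢b (sym b≡a)

¬InX-⟅a,a⟆ : ∀ a → ¬ InX ⟅ a , a ⟆
¬InX-⟅a,a⟆ a with a ≤? a
... | yes _ = λ (_ , _ , a≢a) → a≢a refl
... | no _  = λ (_ , _ , a≢a) → a≢a refl

¬InX-⟅0,a⟆ : ∀ a → ¬ InX ⟅ zero , a ⟆
¬InX-⟅0,a⟆ _ (0≢0 , _) = 0≢0 refl

module _ (T : SubsetX₀) (nice : GenNice T) where

  ⟅i,i⟆∧⟅j,i*j⟆⇒⟅i,j⟆∧⟅i,i*j⟆ : ∀ {i j} → ⟅ i , i ⟆ ∈ₚ T → ⟅ j , i * j ⟆ ∈ₚ T
                               → ⟅ i , j ⟆ ∈ₚ T × ⟅ i , i * j ⟆ ∈ₚ T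
  ⟅i,i⟆∧⟅j,i*j⟆⇒⟅i,j⟆∧⟅i,i*j⟆ {i} {j} ⟅i,i⟆∈T ⟅j,i*j⟆∈T =
    ⟅i,j⟆∈T , subst T (⟅⟆-comm (i * j) i) ⟅i*j,i⟆∈T
    where
    ⟅j*[i*j],i⟆∈T : ⟅ j * (i * j) , i ⟆ ∈ₚ T
    ⟅j*[i*j],i⟆∈T = subst (λ x → ⟅ x , i ⟆ ∈ₚ T) (sym (b*[a*b]≡a i j)) ⟅i,i⟆∈T
    P : P⊆ j (i * j) i T
    P = nice j (i * j) i ⟅j,i*j⟆∈T ⟅j*[i*j],i⟆∈T
    ⟅i*j,i⟆∈T : ⟅ i * j , i ⟆ ∈ₚ T
    ⟅i*j,i⟆∈T = proj₁ (proj₂ P)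
    ⟅i,j⟆∈T : ⟅ i , j ⟆ ∈ₚ T
    ⟅i,j⟆∈T = proj₁ (proj₂ (proj₂ P))

  ⟅i,j⟆∧⟅i,i*j⟆⇒⟅0,i*j⟆ : ∀ {i j} → ⟅ i , j ⟆ ∈ₚ T → ⟅ i , i * j ⟆ ∈ₚ T
                         → ⟅ zero , i * j ⟆ ∈ₚ T
  ⟅i,j⟆∧⟅i,i*j⟆⇒⟅0,i*j⟆ {i} {j} ⟅i,j⟆∈T ⟅i,i*j⟆∈T =
    subst T (⟅⟆-comm (i * j) zero) ⟅i*j,0⟆∈T
    where
    ⟅i*[i*j],i⟆∈T : ⟅ i * (i * j) , i ⟆ ∈ₚ T
    ⟅i*[i*j],i⟆∈T = subst (λ x → ⟅ x , i ⟆ ∈ₚ T) (sym (a*[a*b]≡b i j))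
                          (subst T (⟅⟆-comm i j) ⟅i,j⟆∈T)
    P : P⊆ i (i * j) i T
    P = nice i (i * j) i ⟅i,i*j⟆∈T ⟅i*[i*j],i⟆∈T
    ⟅i*j,i*i⟆∈T : ⟅ i * j , i * i ⟆ ∈ₚ T
    ⟅i*j,i*i⟆∈T = proj₁ (proj₂ (proj₂ (proj₂ (proj₂ P))))
    ⟅i*j,0⟆∈T : ⟅ i * j , zero ⟆ ∈ₚ T
    ⟅i*j,0⟆∈T = subst (λ x → ⟅ i * j , x ⟆ ∈ₚ T) (*-self i) ⟅i*j,i*i⟆∈T

  ⟅i,i⟆∧⟅0,k⟆⇒⟅i,k⟆ : ∀ {i k} → ⟅ i , i ⟆ ∈ₚ T → ⟅ zero , k ⟆ ∈ₚ T → ⟅ i , k ⟆ ∈ₚ T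
  ⟅i,i⟆∧⟅0,k⟆⇒⟅i,k⟆ {i} {k} ⟅i,i⟆∈T ⟅0,k⟆∈T =
    proj₁ (proj₂ (nice i i k ⟅i,i⟆∈T ⟅i*i,k⟆∈T))
    where
    ⟅i*i,k⟆∈T : ⟅ i * i , k ⟆ ∈ₚ T
    ⟅i*i,k⟆∈T = subst (λ x → ⟅ x , k ⟆ ∈ₚ T) (sym (*-self i)) ⟅0,k⟆∈T

lemma6p1 : (T : SubsetX₀) → GenNice T → GenNice (T ∖X)
    → ¬ (Σ I₀ λ i → Σ I₀ λ j → InI i × InI j × i ≢ j
          × (⟅ i , i ⟆ ∈ₚ T) × (⟅ j , i * j ⟆ ∈ₚ T))
lemma6p1 T nice nice∖X (i , j , i≢0 , j≢0 , i≢j , ⟅i,i⟆∈T , ⟅j,i*j⟆∈T) =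
  proj₂ ⟅i,i*j⟆∈T∖X (InX-⟅⟆ i (i * j) i≢0 i*j≢0 i≢i*j)
  where
  i*j≢0 : InI (i * j)
  i*j≢0 i*j≡0 = i≢j (a*b≡0⇒a≡b i j i*j≡0)
  i≢i*j : i ≢ i * j
  i≢i*j i≡i*j = j≢0 (a*b≡a⇒b≡0 i j (sym i≡i*j))
  ⟅0,i*j⟆∈T : ⟅ zero , i * j ⟆ ∈ₚ T
  ⟅0,i*j⟆∈T = uncurry (⟅i,j⟆∧⟅i,i*j⟆⇒⟅0,i*j⟆ T nice)
                      (⟅i,i⟆∧⟅j,i*j⟆⇒⟅i,j⟆∧⟅i,i*j⟆ T nice ⟅i,i⟆∈T ⟅j,i*j⟆∈T)
  ⟅i,i*j⟆∈T∖X : ⟅ i , i * j ⟆ ∈ₚ (T ∖X)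
  ⟅i,i*j⟆∈T∖X = ⟅i,i⟆∧⟅0,k⟆⇒⟅i,k⟆ (T ∖X) nice∖X (⟅i,i⟆∈T , ¬InX-⟅a,a⟆ i)
                                                (⟅0,i*j⟆∈T , ¬InX-⟅0,a⟆ (i * j))
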